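{- Let $n\ge 1$ and let $k\ge 1$ be an integer such that $\sqrt{k}$ is an integer. Let $p$ be a prime with $p>n$, and let $V$ be the $n\times \sqrt{k}$ integer matrix with entries in $\{1,\dots,p\}$ such that $V_{ij}\equiv i^{j-1}\pmod p$. Let $A,B,C$ be $n\times n$ integer matrices such that $AB-C$ has at most $k$ nonzero entries. If $(AB-C)^TV=\mathbf{0}$ and $(AB-C)V=\mathbf{0}$, then $AB=C$.
   Context: The matrices $(AB-C)^TV$ and $(AB-C)V$ are called the column-indicator and row-indicator of $AB-C$, respectively. All products are ordinary matrix products over the integers. -}

module Defs where

open import Data.Nat using (ℕ; zero; suc)
import Data.Nat as ℕ
open import Data.Fin using (Fin; toℕ)
open import Data.Integer using (ℤ; +_; _+_; _*_; _-_)
open import Relation.Nullary using (does)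
open import Data.Bool using (if_then_else_)

-- Integer matrices with m rows and n columns, indexed from 0.
Matrix : ℕ → ℕ → Set
Matrix m n = Fin m → Fin n → ℤ

∑ : ∀ {n} → (Fin n → ℤ) → ℤ
∑ {zero}  f = + 0
∑ {suc n} f = f Fin.zero + ∑ (λ i → f (Fin.suc i))
  where import Data.Fin as Fin

∑ℕ : ∀ {n} → (Fin n → ℕ) → ℕ
∑ℕ {zero}  f = 0
∑ℕ {suc n} f = f Fin.zero ℕ.+ ∑ℕ (λ i → f (Fin.suc i))
  where import Data.Fin as Fin

_⊗_ : ∀ {m n r} → Matrix m n → Matrix n r → Matrix m r
(A ⊗ B) i j = ∑ (λ l → A i l * B l j)

_⊖_ : ∀ {m n} → Matrix m n → Matrix m n → Matrix m n
(A ⊖ B) i j = A i j - B i j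

transpose : ∀ {m n} → Matrix m n → Matrix n m
transpose A i j = A j i

zeroM : ∀ {m n} → Matrix m n
zeroM _ _ = + 0

nnz : ∀ {m n} → Matrix m n → ℕ
nnz A = ∑ℕ (λ i → ∑ℕ (λ j → if does (A i j Data.Integer.≟ + 0) then 0 else 1))

{-# OPTIONS --safe #-}
-- Every row and every column of D = AB − C lies in the left kernel of V, and a vector x with
-- at most s nonzero entries and xᵀV = 0 must vanish: modulo p the equations say that the power
-- sums ∑ x_j (j+1)^l vanish for l < s at pairwise distinct nodes, which forces p ∣ x_j for all j,
-- and x/p again satisfies the hypotheses, so x = 0 by infinite descent. Hence a nonzero entry of
-- D would make its row, and every column through a nonzero entry of that row, carry more than s
-- nonzero entries, i.e. D would have more than s² = k nonzero entries.
module Submission where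

open import Defs
open import Data.Nat using (ℕ; _≤_; _<_; _^_)
open import Data.Nat.Primality using (Prime)
open import Data.Fin using (Fin; toℕ)
open import Data.Product using (_×_)
open import Data.Integer using (ℤ; +_)
open import Data.Integer.Divisibility using (_∣_)
open import Relation.Binary.PropositionalEquality using (_≡_)
import Data.Nat as N
import Data.Integer as Z

open import Data.Bool using (if_then_else_)
open import Data.Fin using (zero; suc; fromℕ<)
open import Data.Fin.Properties using (suc-injective; toℕ<n; toℕ-injective; toℕ-fromℕ<)
open import Data.Integer using (0ℤ; 1ℤ; _+_; _-_; _*_; ∣_∣; _≟_)
open import Data.Integer.Divisibility.Signed as Signed using (_∣?_) renaming (_∣_ to _∣ₛ_)
open import Data.Integer.Tactic.RingSolver using (solve-∀)
open import Data.Nat using (zero; suc; z≤n; s≤s; nonTrivial⇒n>1)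
open import Data.Nat.Primality using (euclidsLemma; prime⇒nonZero; prime⇒nonTrivial)
open import Data.Product using (_,_; ∃)
open import Data.Sum using (_⊎_; [_,_]′)
import Data.Sum as Sum
open import Function using (_∘_; id)
open import Relation.Binary.PropositionalEquality using (_≢_; refl; sym; trans; cong; cong₂; subst; subst₂; module ≡-Reasoning)
open import Relation.Nullary using (Dec; yes; no; does; ¬_; contradiction)
open import Relation.Unary using (Pred; Decidable)
import Algebra.Properties.Semiring.Sum as SemiringSum
import Data.Nat.Divisibility as ND
import Data.Nat.Properties as NP
import Data.Integer.Properties as ZP

module ℕΣ = SemiringSum NP.+-*-semiring

∑-cong : ∀ {n} {f g : Fin n → ℤ} → (∀ j → f j ≡ g j) → ∑ f ≡ ∑ g
∑-cong {zero}  f≗g = refl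
∑-cong {suc n} f≗g = cong₂ _+_ (f≗g zero) (∑-cong (f≗g ∘ suc))

∑-*ˡ : ∀ {n} c (f : Fin n → ℤ) → c * ∑ f ≡ ∑ (λ j → c * f j)
∑-*ˡ {zero}  c f = ZP.*-zeroʳ c
∑-*ˡ {suc n} c f = trans (ZP.*-distribˡ-+ c (f zero) _) (cong (λ t → c * f zero + t) (∑-*ˡ c (f ∘ suc)))

∑-distrib-- : ∀ {n} (f g : Fin n → ℤ) → ∑ (λ j → f j - g j) ≡ ∑ f - ∑ g
∑-distrib-- {zero}  f g = refl
∑-distrib-- {suc n} f g =
  trans (cong (λ t → f zero - g zero + t) (∑-distrib-- (f ∘ suc) (g ∘ suc))) (interchange (f zero) (g zero) _ _)
  where
  interchange : ∀ a b c d → a - b + (c - d) ≡ a + c - (b + d)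
  interchange = solve-∀

_∣0 : ∀ d → d ∣ₛ 0ℤ
d ∣0 = Signed.divides 0ℤ refl

∑-∣ : ∀ {n d} {f : Fin n → ℤ} → (∀ j → d ∣ₛ f j) → d ∣ₛ ∑ f
∑-∣ {zero}  {d} _   = d ∣0
∑-∣ {suc n}     d∣f = Signed.∣m∣n⇒∣m+n (d∣f zero) (∑-∣ (d∣f ∘ suc))

∑-cong-mod : ∀ {n d} (f g : Fin n → ℤ) → (∀ j → d ∣ₛ f j - g j) → d ∣ₛ ∑ f - ∑ g
∑-cong-mod f g d∣f-g = subst (_ ∣ₛ_) (∑-distrib-- f g) (∑-∣ d∣f-g)

∣∑⇒∣ : ∀ {n d} (f : Fin n → ℤ) c → d ∣ₛ ∑ f → (∀ j → j ≢ c → d ∣ₛ f j) → d ∣ₛ f c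
∣∑⇒∣ {suc n} f zero    d∣∑ d∣f = Signed.∣m+n∣n⇒∣m d∣∑ (∑-∣ (λ j → d∣f (suc j) λ ()))
∣∑⇒∣ {suc n} f (suc c) d∣∑ d∣f =
  ∣∑⇒∣ (f ∘ suc) c (Signed.∣m+n∣m⇒∣n d∣∑ (d∣f zero λ ())) (λ j j≢c → d∣f (suc j) (j≢c ∘ suc-injective))

∑ℕ-mono : ∀ {n} {f g : Fin n → ℕ} → (∀ j → f j ≤ g j) → ∑ℕ f ≤ ∑ℕ g
∑ℕ-mono {zero}  f≤g = z≤n
∑ℕ-mono {suc n} f≤g = NP.+-mono-≤ (f≤g zero) (∑ℕ-mono (f≤g ∘ suc))

∑ℕ-mono-< : ∀ {n} {f g : Fin n → ℕ} c → (∀ j → f j ≤ g j) → f c < g c → ∑ℕ f < ∑ℕ g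
∑ℕ-mono-< zero    f≤g fc<gc = NP.+-mono-<-≤ fc<gc (∑ℕ-mono (f≤g ∘ suc))
∑ℕ-mono-< (suc c) f≤g fc<gc = NP.+-mono-≤-< (f≤g zero) (∑ℕ-mono-< c (f≤g ∘ suc) fc<gc)

∑ℕ≡sum : ∀ {n} (f : Fin n → ℕ) → ∑ℕ f ≡ ℕΣ.sum f
∑ℕ≡sum {zero}  f = refl
∑ℕ≡sum {suc n} f = cong (f zero N.+_) (∑ℕ≡sum (f ∘ suc))

∑ℕ-*ʳ : ∀ {n} (f : Fin n → ℕ) c → ∑ℕ f N.* c ≡ ∑ℕ (λ j → f j N.* c)
∑ℕ-*ʳ f c = begin
  ∑ℕ f N.* c                     ≡⟨ cong (N._* c) (∑ℕ≡sum f) ⟩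
  ℕΣ.sum f N.* c                 ≡⟨ ℕΣ.*-distribʳ-sum c f ⟩
  ℕΣ.sum (λ j → f j N.* c)       ≡⟨ sym (∑ℕ≡sum (λ j → f j N.* c)) ⟩
  ∑ℕ (λ j → f j N.* c)           ∎
  where open ≡-Reasoning

∑ℕ-comm : ∀ {m n} (f : Fin m → Fin n → ℕ) → ∑ℕ (λ i → ∑ℕ (f i)) ≡ ∑ℕ (λ j → ∑ℕ (λ i → f i j))
∑ℕ-comm f = begin
  ∑ℕ (λ i → ∑ℕ (f i))                   ≡⟨ ∑∑ℕ≡sum∑ f ⟩
  ℕΣ.sum (λ i → ℕΣ.sum (f i))           ≡⟨ ℕΣ.∑-comm f ⟩
  ℕΣ.sum (λ j → ℕΣ.sum (λ i → f i j))   ≡⟨ sym (∑∑ℕ≡sum∑ (λ j i → f i j)) ⟩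
  ∑ℕ (λ j → ∑ℕ (λ i → f i j))           ∎
  where
  open ≡-Reasoning
  ∑∑ℕ≡sum∑ : ∀ {m n} (g : Fin m → Fin n → ℕ) → ∑ℕ (λ i → ∑ℕ (g i)) ≡ ℕΣ.sum (λ i → ℕΣ.sum (g i))
  ∑∑ℕ≡sum∑ g = trans (∑ℕ≡sum (λ i → ∑ℕ (g i))) (ℕΣ.sum-cong-≗ (λ i → ∑ℕ≡sum (g i)))

¬-indicator : ∀ {ℓ} {P : Set ℓ} → Dec P → ℕ
¬-indicator P? = if does P? then 0 else 1

¬-indicator-mono : ∀ {ℓ ℓ′} {P : Set ℓ} {Q : Set ℓ′} (P? : Dec P) (Q? : Dec Q) →
                   (Q → P) → ¬-indicator P? ≤ ¬-indicator Q?
¬-indicator-mono (yes _) _       _   = z≤n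
¬-indicator-mono (no ¬p) (yes q) Q⇒P = contradiction (Q⇒P q) ¬p
¬-indicator-mono (no _)  (no _)  _   = NP.≤-refl

count¬ : ∀ {a ℓ} {A : Set a} {P : Pred A ℓ} → Decidable P → ∀ {n} → (Fin n → A) → ℕ
count¬ P? x = ∑ℕ (λ j → ¬-indicator (P? (x j)))

module _ {a b ℓ ℓ′} {A : Set a} {B : Set b} {P : Pred A ℓ} {Q : Pred B ℓ′}
         (P? : Decidable P) (Q? : Decidable Q) {n} {x : Fin n → A} {y : Fin n → B} where

  count¬-mono : (∀ j → Q (y j) → P (x j)) → count¬ P? x ≤ count¬ Q? y
  count¬-mono Q⇒P = ∑ℕ-mono (λ j → ¬-indicator-mono (P? (x j)) (Q? (y j)) (Q⇒P j))

  count¬-mono-< : ∀ c → (∀ j → Q (y j) → P (x j)) → P (x c) → ¬ Q (y c) → count¬ P? x < count¬ Q? y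
  count¬-mono-< c Q⇒P Pxc ¬Qyc = ∑ℕ-mono-< c (λ j → ¬-indicator-mono (P? (x j)) (Q? (y j)) (Q⇒P j)) xc<yc
    where
    xc<yc : ¬-indicator (P? (x c)) < ¬-indicator (Q? (y c))
    xc<yc with P? (x c) | Q? (y c)
    ... | yes _   | no _   = s≤s z≤n
    ... | no ¬Pxc | _      = contradiction Pxc ¬Pxc
    ... | _       | yes Qyc = contradiction Qyc ¬Qyc

nonzeros : ∀ {n} → (Fin n → ℤ) → ℕ
nonzeros = count¬ (_≟ 0ℤ)

sparse-lines⇒zero : ∀ {m n} s (M : Matrix m n) →
  (∀ i → nonzeros (M i) ≤ s → ∀ j → M i j ≡ 0ℤ) →
  (∀ j → nonzeros (λ i → M i j) ≤ s → ∀ i → M i j ≡ 0ℤ) →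
  nnz M ≤ s N.* s → ∀ i j → M i j ≡ 0ℤ
sparse-lines⇒zero s M sparse-row sparse-col nnz≤s² i j with M i j ≟ 0ℤ
... | yes Mij≡0 = Mij≡0
... | no  Mij≢0 = contradiction nnz≤s² (NP.<⇒≱ s²<nnz)
  where
  open NP.≤-Reasoning
  row-dense : suc s ≤ nonzeros (M i)
  row-dense = NP.≰⇒> (λ sparse → Mij≢0 (sparse-row i sparse j))
  col-dense : ∀ j′ → ¬-indicator (M i j′ ≟ 0ℤ) N.* suc s ≤ nonzeros (λ i′ → M i′ j′)
  col-dense j′ with M i j′ ≟ 0ℤ
  ... | yes _    = z≤n
  ... | no Mij′≢0 = subst (_≤ nonzeros (λ i′ → M i′ j′)) (sym (NP.+-identityʳ (suc s)))
                      (NP.≰⇒> (λ sparse → Mij′≢0 (sparse-col j′ sparse i)))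
  s²<nnz : s N.* s < nnz M
  s²<nnz = begin-strict
    s N.* s                                        <⟨ NP.*-mono-< (NP.n<1+n s) (NP.n<1+n s) ⟩
    suc s N.* suc s                                ≤⟨ NP.*-monoˡ-≤ (suc s) row-dense ⟩
    nonzeros (M i) N.* suc s                       ≡⟨ ∑ℕ-*ʳ (λ j′ → ¬-indicator (M i j′ ≟ 0ℤ)) (suc s) ⟩
    ∑ℕ (λ j′ → ¬-indicator (M i j′ ≟ 0ℤ) N.* suc s)  ≤⟨ ∑ℕ-mono col-dense ⟩
    ∑ℕ (λ j′ → nonzeros (λ i′ → M i′ j′))          ≡⟨ sym (∑ℕ-comm (λ i′ j′ → ¬-indicator (M i′ j′ ≟ 0ℤ))) ⟩
    nnz M                                          ∎

∣m∣m-n⇒∣n : ∀ {d m n} → d ∣ₛ m → d ∣ₛ m - n → d ∣ₛ n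
∣m∣m-n⇒∣n {m = m} {n} d∣m d∣m-n = subst (_ ∣ₛ_) (m-[m-n]≡n m n) (Signed.∣m∣n⇒∣m-n d∣m d∣m-n)
  where
  m-[m-n]≡n : ∀ m n → m - (m - n) ≡ n
  m-[m-n]≡n = solve-∀

∣∧<⇒≡0 : ∀ {p m} → p ND.∣ m → m < p → m ≡ 0
∣∧<⇒≡0 {m = zero}  _   _   = refl
∣∧<⇒≡0 {m = suc m} p∣m m<p = contradiction (ND.∣⇒≤ p∣m) (NP.<⇒≱ m<p)

prime∣*⇒∣ : ∀ {p i j} → Prime p → + p ∣ₛ i * j → + p ∣ₛ i ⊎ + p ∣ₛ j
prime∣*⇒∣ {i = i} {j} p-prime p∣ij =
  Sum.map Signed.∣ᵤ⇒∣ Signed.∣ᵤ⇒∣ (euclidsLemma ∣ i ∣ ∣ j ∣ p-prime (subst (_ ND.∣_) (ZP.abs-* i j) (Signed.∣⇒∣ᵤ p∣ij)))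

n<m^n : ∀ {m} → 1 < m → ∀ n → n < m ^ n
n<m^n 1<m zero    = s≤s z≤n
n<m^n 1<m (suc n) = NP.≤-<-trans (n<m^n 1<m n) (NP.^-monoʳ-< _ 1<m (NP.n<1+n n))

pos-^ : ∀ m k → + (m ^ k) ≡ (+ m) Z.^ k
pos-^ m zero    = refl
pos-^ m (suc k) = trans (ZP.pos-* m (m ^ k)) (cong (λ t → + m * t) (pos-^ m k))

module Moments {p} (p-prime : Prime p) {n} (a : Fin n → ℤ)
               (a-injective-mod-p : ∀ {i j} → + p ∣ₛ a i - a j → i ≡ j) where

  moment : (Fin n → ℤ) → ℕ → ℤ
  moment x l = ∑ (λ j → x j * a j Z.^ l)

  nondivisibles : (Fin n → ℤ) → ℕ
  nondivisibles = count¬ (+ p ∣?_)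

  deflate : Fin n → (Fin n → ℤ) → Fin n → ℤ
  deflate c x j = (a j - a c) * x j

  moment-deflate : ∀ c x l → moment (deflate c x) l ≡ moment x (suc l) - a c * moment x l
  moment-deflate c x l = begin
    ∑ (λ j → (a j - a c) * x j * a j Z.^ l)
      ≡⟨ ∑-cong (λ j → expand (a j) (a c) (x j) (a j Z.^ l)) ⟩
    ∑ (λ j → x j * a j Z.^ suc l - a c * (x j * a j Z.^ l))
      ≡⟨ ∑-distrib-- (λ j → x j * a j Z.^ suc l) (λ j → a c * (x j * a j Z.^ l)) ⟩
    moment x (suc l) - ∑ (λ j → a c * (x j * a j Z.^ l))
      ≡⟨ cong (λ t → moment x (suc l) - t) (sym (∑-*ˡ (a c) (λ j → x j * a j Z.^ l))) ⟩
    moment x (suc l) - a c * moment x l ∎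
    where
    open ≡-Reasoning
    expand : ∀ b c y q → (b - c) * y * q ≡ y * (b * q) - c * (y * q)
    expand = solve-∀

  deflate-fewer : ∀ c x → ¬ + p ∣ₛ x c → nondivisibles (deflate c x) < nondivisibles x
  deflate-fewer c x p∤xc = count¬-mono-< (+ p ∣?_) (+ p ∣?_) c
    (λ j → Signed.∣n⇒∣m*n (a j - a c))
    (subst (λ t → + p ∣ₛ t * x c) (sym (ZP.+-inverseʳ (a c))) (Signed.∣m⇒∣m*n (x c) ((+ p) ∣0)))
    p∤xc

  ∣deflate⇒∣ : ∀ {c i} x → i ≢ c → + p ∣ₛ deflate c x i → + p ∣ₛ x i
  ∣deflate⇒∣ x i≢c = [ (λ p∣ai-ac → contradiction (a-injective-mod-p p∣ai-ac) i≢c) , id ]′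
                   ∘ prime∣*⇒∣ p-prime

  -- Deflating at c removes the entry at c and shifts the moments down by one, so induction on
  -- the number of entries not divisible by p gives p ∣ x i for i ≢ c; the zeroth moment then
  -- gives p ∣ x c.
  moments∣⇒∣ : ∀ r x → nondivisibles x ≤ r → (∀ l → l < r → + p ∣ₛ moment x l) → ∀ c → + p ∣ₛ x c
  moments∣⇒∣ r x few moments∣ c with + p ∣? x c
  ... | yes p∣xc = p∣xc
  moments∣⇒∣ zero    x few moments∣ c | no p∤xc = contradiction (NP.<-≤-trans (deflate-fewer c x p∤xc) few) NP.n≮0
  moments∣⇒∣ (suc r) x few moments∣ c | no p∤xc =
    subst (_ ∣ₛ_) (ZP.*-identityʳ (x c))
      (∣∑⇒∣ (λ j → x j * 1ℤ) c (moments∣ 0 (s≤s z≤n))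
        (λ i i≢c → subst (_ ∣ₛ_) (sym (ZP.*-identityʳ (x i))) (∣deflate⇒∣ x i≢c (deflate-divisible i))))
    where
    deflate-divisible : ∀ i → + p ∣ₛ deflate c x i
    deflate-divisible = moments∣⇒∣ r (deflate c x)
      (NP.≤-pred (NP.≤-trans (deflate-fewer c x p∤xc) few))
      (λ l l<r → subst (_ ∣ₛ_) (sym (moment-deflate c x l))
        (Signed.∣m∣n⇒∣m-n (moments∣ (suc l) (s≤s l<r)) (Signed.∣n⇒∣m*n (a c) (moments∣ l (NP.m<n⇒m<1+n l<r)))))

module _ {p} (1<p : 1 < p) {I : Set} (Φ : (I → ℤ) → Set)
         (Φ-divisible : ∀ x → Φ x → ∃ λ y → (∀ i → x i ≡ y i * + p) × Φ y) where

  Φ⇒p^e∣ : ∀ e x → Φ x → ∀ i → p ^ e ND.∣ ∣ x i ∣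
  Φ⇒p^e∣ zero    x _  i = ND.1∣ ∣ x i ∣
  Φ⇒p^e∣ (suc e) x Φx i with Φ-divisible x Φx
  ... | y , x≡y*p , Φy =
    subst₂ ND._∣_ (NP.*-comm (p ^ e) p) (sym ∣xi∣≡∣yi∣*p) (ND.*-monoˡ-∣ p (Φ⇒p^e∣ e y Φy i))
    where
    ∣xi∣≡∣yi∣*p : ∣ x i ∣ ≡ ∣ y i ∣ N.* p
    ∣xi∣≡∣yi∣*p = trans (cong ∣_∣ (x≡y*p i)) (ZP.abs-* (y i) (+ p))

  divisible-descent : ∀ x → Φ x → ∀ i → x i ≡ 0ℤ
  divisible-descent x Φx i = ZP.∣i∣≡0⇒i≡0 (∣∧<⇒≡0 (Φ⇒p^e∣ ∣ x i ∣ x Φx i) (n<m^n 1<p ∣ x i ∣))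

module VandermondeKernel {n s p} (p-prime : Prime p) (n<p : n < p) (V : Matrix n s)
  (V≡powers : ∀ i j → + p ∣ (V i j Z.- + ((N.suc (toℕ i)) ^ (toℕ j)))) where

  node : Fin n → ℤ
  node j = + suc (toℕ j)

  node-injective-mod-p : ∀ {i j} → + p ∣ₛ node i - node j → i ≡ j
  node-injective-mod-p {i} {j} p∣ = toℕ-injective (NP.suc-injective (ZP.+-injective
    (ZP.i-j≡0⇒i≡j (node i) (node j) (ZP.∣i∣≡0⇒i≡0 (∣∧<⇒≡0 (Signed.∣⇒∣ᵤ p∣) ∣node-node∣<p)))))
    where
    ∣node-node∣<p : ∣ node i - node j ∣ < p
    ∣node-node∣<p = NP.≤-<-trans
      (subst (_≤ suc (toℕ i) N.⊔ suc (toℕ j)) (cong ∣_∣ (sym (ZP.m-n≡m⊖n (suc (toℕ i)) (suc (toℕ j)))))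
        (ZP.∣m⊝n∣≤m⊔n (suc (toℕ i)) (suc (toℕ j))))
      (NP.≤-<-trans (NP.⊔-lub (toℕ<n i) (toℕ<n j)) n<p)

  open Moments p-prime node node-injective-mod-p

  V≡node^ : ∀ j {l} (l<s : l < s) → + p ∣ₛ V j (fromℕ< l<s) - node j Z.^ l
  V≡node^ j {l} l<s = subst (λ t → + p ∣ₛ V j (fromℕ< l<s) - t)
    (trans (cong (λ e → + (suc (toℕ j) ^ e)) (toℕ-fromℕ< l<s)) (pos-^ (suc (toℕ j)) l))
    (Signed.∣ᵤ⇒∣ (V≡powers j (fromℕ< l<s)))

  SparseKernel : (Fin n → ℤ) → Set
  SparseKernel x = nonzeros x ≤ s × (∀ l → ∑ (λ j → x j * V j l) ≡ 0ℤ)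

  kernel⇒moments∣ : ∀ x → (∀ l → ∑ (λ j → x j * V j l) ≡ 0ℤ) → ∀ l → l < s → + p ∣ₛ moment x l
  kernel⇒moments∣ x x·V≡0 l l<s = ∣m∣m-n⇒∣n (subst (_ ∣ₛ_) (sym (x·V≡0 L)) ((+ p) ∣0))
    (∑-cong-mod (λ j → x j * V j L) (λ j → x j * node j Z.^ l)
      (λ j → subst (_ ∣ₛ_) (factor (x j) (V j L) (node j Z.^ l)) (Signed.∣n⇒∣m*n (x j) (V≡node^ j l<s))))
    where
    L : Fin s
    L = fromℕ< l<s
    factor : ∀ y v q → y * (v - q) ≡ y * v - y * q
    factor = solve-∀

  sparse-kernel-divisible : ∀ x → SparseKernel x → ∃ λ y → (∀ j → x j ≡ y j * + p) × SparseKernel y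
  sparse-kernel-divisible x (sparse , x·V≡0) = y , x≡y*p , y-sparse , y·V≡0
    where
    instance
      p≢0 : N.NonZero p
      p≢0 = prime⇒nonZero p-prime
    p∣x : ∀ j → + p ∣ₛ x j
    p∣x = moments∣⇒∣ s x
      (NP.≤-trans (count¬-mono (+ p ∣?_) (_≟ 0ℤ) {x = x} {y = x} (λ j x≡0 → subst (_ ∣ₛ_) (sym x≡0) ((+ p) ∣0))) sparse)
      (kernel⇒moments∣ x x·V≡0)
    y : Fin n → ℤ
    y j = Signed.quotient (p∣x j)
    x≡y*p : ∀ j → x j ≡ y j * + p
    x≡y*p j = Signed._∣_.equality (p∣x j)
    y-sparse : nonzeros y ≤ s
    y-sparse = NP.≤-trans
      (count¬-mono (_≟ 0ℤ) (_≟ 0ℤ) {x = y} {y = x} (λ j x≡0 → ZP.*-cancelʳ-≡ (y j) 0ℤ (+ p) (trans (sym (x≡y*p j)) x≡0)))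
      sparse
    y·V≡0 : ∀ l → ∑ (λ j → y j * V j l) ≡ 0ℤ
    y·V≡0 l = ZP.*-cancelˡ-≡ (+ p) _ 0ℤ (begin
      + p * ∑ (λ j → y j * V j l)    ≡⟨ ∑-*ˡ (+ p) (λ j → y j * V j l) ⟩
      ∑ (λ j → + p * (y j * V j l))  ≡⟨ ∑-cong (λ j → trans (reassoc (+ p) (y j) (V j l))
                                                           (cong (_* V j l) (sym (x≡y*p j)))) ⟩
      ∑ (λ j → x j * V j l)          ≡⟨ x·V≡0 l ⟩
      0ℤ                             ≡⟨ sym (ZP.*-zeroʳ (+ p)) ⟩
      + p * 0ℤ                       ∎)
      where
      open ≡-Reasoning
      reassoc : ∀ q z v → q * (z * v) ≡ z * q * v
      reassoc = solve-∀

  sparse-kernel≡0 : ∀ x → SparseKernel x → ∀ j → x j ≡ 0ℤ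
  sparse-kernel≡0 =
    divisible-descent (nonTrivial⇒n>1 p {{prime⇒nonTrivial p-prime}}) SparseKernel sparse-kernel-divisible

-- Only the congruence V i j ≡ (i+1)^j (mod p) is used.
lemma3 : (n k s p : ℕ) → 1 ≤ n → 1 ≤ k → k ≡ s N.* s → Prime p → n < p →
    (V : Matrix n s) →
    (∀ i j → + 1 Z.≤ V i j × V i j Z.≤ + p) →
    (∀ i j → + p ∣ (V i j Z.- + ((N.suc (toℕ i)) ^ (toℕ j)))) →
    (A B C : Matrix n n) →
    nnz ((A ⊗ B) ⊖ C) ≤ k →
    (∀ i j → (transpose ((A ⊗ B) ⊖ C) ⊗ V) i j ≡ zeroM i j) →
    (∀ i j → (((A ⊗ B) ⊖ C) ⊗ V) i j ≡ zeroM i j) →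
    ∀ i j → (A ⊗ B) i j ≡ C i j
lemma3 n k s p _ _ k≡s*s p-prime n<p V _ V≡powers A B C nnz≤k col-kernel row-kernel i j =
  ZP.i-j≡0⇒i≡j _ _ (sparse-lines⇒zero s D sparse-row⇒0 sparse-col⇒0 (subst (nnz D ≤_) k≡s*s nnz≤k) i j)
  where
  open VandermondeKernel p-prime n<p V V≡powers
  D : Matrix n n
  D = (A ⊗ B) ⊖ C
  sparse-row⇒0 : ∀ i → nonzeros (D i) ≤ s → ∀ j → D i j ≡ 0ℤ
  sparse-row⇒0 i sparse = sparse-kernel≡0 (D i) (sparse , row-kernel i)
  sparse-col⇒0 : ∀ j → nonzeros (λ i → D i j) ≤ s → ∀ i → D i j ≡ 0ℤ
  sparse-col⇒0 j sparse = sparse-kernel≡0 (λ i → D i j) (sparse , col-kernel j)
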